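{- Let $n\ge 5$ and let $\mathbf{u}=(u_1,\dots,u_n),\mathbf{v}=(v_1,\dots,v_n)\in\{0,1\}^n$ with $\mathbf{v}\ne 0^n,1^n$. Suppose $\mathbf{u}$ is $2$-dominant over $\mathbf{v}$, $u_1\neq v_1$ and $u_n\neq v_n$. Then, up to equivalence, there exists $\{p,q\}=\{0,1\}$ such that either $\mathbf{u}=qpq^{n-4}pq$ and $\mathbf{v}=pq^{n-2}p$, or $\mathbf{u}=qp^{n-3}qp$ and $\mathbf{v}=p^{n-1}q$.
   Context: For a binary vector $\mathbf{u}$ of length $n$, $D_2(\mathbf{u})$ denotes the set of all vectors of length $n-2$ obtained from $\mathbf{u}$ by deleting $2$ entries (all subsequences of length $n-2$). $\mathbf{u}$ is $2$-dominant over $\mathbf{v}$ if $\mathbf{u}\neq\mathbf{v}$ and $D_2(\mathbf{v})\subseteq D_2(\mathbf{u})$. For $p\in\{0,1\}$ and $a\ge0$, $p^a$ is the string of $a$ copies of $p$, and juxtaposition denotes concatenation. "Up to equivalence" means up to applying the same one of the following transformations to both $\mathbf{u}$ and $\mathbf{v}$: complementing every entry; reversing the order of the entries; or both. -}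

module Defs where

open import Data.Nat using (ℕ; zero; suc)
open import Data.Bool using (Bool; not)
open import Data.List using (List; []; _∷_; map; reverse)
open import Data.Product using (_×_)
open import Relation.Binary.PropositionalEquality using (_≡_; _≢_)

data Del {A : Set} : ℕ → List A → List A → Set where
  done : Del 0 [] []
  keep : ∀ {k x xs ys} → Del k xs ys → Del k (x ∷ xs) (x ∷ ys)
  skip : ∀ {k x xs ys} → Del k xs ys → Del (suc k) (x ∷ xs) ys

_∈D₂_ : List Bool → List Bool → Set
w ∈D₂ u = Del 2 u w

_2-dominant-over_ : List Bool → List Bool → Set
u 2-dominant-over v = (u ≢ v) × (∀ w → w ∈D₂ v → w ∈D₂ u)

-- the four equivalence transformations
data Transform : Set where
  identity complement reversal complement-reversal : Transform

complementV : List Bool → List Bool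
complementV = map not

apply : Transform → List Bool → List Bool
apply identity            u = u
apply complement          u = complementV u
apply reversal            u = reverse u
apply complement-reversal u = reverse (complementV u)

-- Since u and v differ at both ends, a 2-deletion of v that keeps both of its
-- end symbols can only be a 2-deletion of u that removes both of u's end
-- symbols. So for v = p z r and u = q m s, every w ∈ D₂(z) satisfies
-- m = p w r: all 2-deletions of z coincide, which forces z to be constant.
-- What remains is a case analysis on p, the constant symbol of z, and r.
module Submission where

open import Defs
open import Data.Nat using (ℕ; zero; suc; _+_; _≤_; _∸_)
open import Data.Nat.Properties using (suc-injective; m≤n⇒∃[o]m+o≡n)
open import Data.Bool using (Bool; true; false; not)
open import Data.Bool.Properties using (¬-not)
open import Data.List using (List; []; _∷_; _++_; _∷ʳ_; [_]; length; replicate; head; last; reverse)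
open import Data.List.Properties using (∷-injectiveˡ; ∷-injectiveʳ; ∷ʳ-injectiveˡ; ++-assoc; unfold-reverse; reverse-++)
open import Data.Maybe using (just)
open import Data.Maybe.Properties using (just-injective)
open import Data.Product using (Σ; ∃; ∃₂; _×_; _,_)
open import Data.Sum using (_⊎_; inj₁; inj₂)
open import Data.Empty using (⊥-elim)
open import Function using (_∘_)
open import Relation.Binary.PropositionalEquality using (_≡_; _≢_; refl; sym; trans; cong; cong₂; module ≡-Reasoning)

private
  variable
    A : Set
    k : ℕ
    x y x′ y′ : A
    xs ys w : List A

last-∷ʳ : ∀ (xs : List A) → last (xs ∷ʳ x) ≡ just x
last-∷ʳ []           = refl
last-∷ʳ (_ ∷ [])     = refl
last-∷ʳ (_ ∷ y ∷ xs) = last-∷ʳ (y ∷ xs)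

∷-∷ʳ-split : ∀ (xs : List A) {n} → length xs ≡ 2 + n → ∃₂ λ x ys → ∃ λ y → xs ≡ x ∷ (ys ∷ʳ y) × length ys ≡ n
∷-∷ʳ-split (x ∷ y ∷ [])      {zero}  refl = x , [] , y , refl , refl
∷-∷ʳ-split (x ∷ x′ ∷ x″ ∷ xs) {suc n} len
  with x₀ , ys , y , eq , |ys| ← ∷-∷ʳ-split (x′ ∷ x″ ∷ xs) (suc-injective len)
  = x , x₀ ∷ ys , y , cong (x ∷_) eq , cong suc |ys|

replicate-∷ʳ : ∀ n (x : A) → replicate n x ∷ʳ x ≡ x ∷ replicate n x
replicate-∷ʳ zero    x = refl
replicate-∷ʳ (suc n) x = cong (x ∷_) (replicate-∷ʳ n x)

reverse-replicate : ∀ n (x : A) → reverse (replicate n x) ≡ replicate n x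
reverse-replicate zero    x = refl
reverse-replicate (suc n) x = begin
  reverse (x ∷ replicate n x)  ≡⟨ unfold-reverse x (replicate n x) ⟩
  reverse (replicate n x) ∷ʳ x ≡⟨ cong (_∷ʳ x) (reverse-replicate n x) ⟩
  replicate n x ∷ʳ x           ≡⟨ replicate-∷ʳ n x ⟩
  x ∷ replicate n x            ∎
  where open ≡-Reasoning

last-∷ʳ-≢ : ∀ (xs ys : List A) → last (xs ∷ʳ x) ≢ last (ys ∷ʳ y) → x ≢ y
last-∷ʳ-≢ xs ys last≢ x≡y = last≢ (trans (last-∷ʳ xs) (trans (cong just x≡y) (sym (last-∷ʳ ys))))

reverse-∷-∷ʳ : ∀ (x : A) xs y → reverse (x ∷ (xs ∷ʳ y)) ≡ y ∷ (reverse xs ∷ʳ x)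
reverse-∷-∷ʳ x xs y = trans (unfold-reverse x (xs ∷ʳ y)) (cong (_∷ʳ x) (reverse-++ xs [ y ]))

Del-refl : ∀ (xs : List A) → Del 0 xs xs
Del-refl []       = done
Del-refl (x ∷ xs) = keep (Del-refl xs)

Del-0⇒≡ : Del 0 xs ys → xs ≡ ys
Del-0⇒≡ done     = refl
Del-0⇒≡ (keep d) = cong (_ ∷_) (Del-0⇒≡ d)

Del-++ʳ : ∀ zs → Del k xs ys → Del k (xs ++ zs) (ys ++ zs)
Del-++ʳ zs done     = Del-refl zs
Del-++ʳ zs (keep d) = keep (Del-++ʳ zs d)
Del-++ʳ zs (skip d) = skip (Del-++ʳ zs d)

Del-∷ʳ⁻ : ∀ {k} (xs : List A) {x ys} → last ys ≢ just x → Del (suc k) (xs ∷ʳ x) ys → Del k xs ys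
Del-∷ʳ⁻ []       last≢x (keep ())
Del-∷ʳ⁻ []       last≢x (skip done) = done
Del-∷ʳ⁻ (_ ∷ xs) {ys = _ ∷ []}    last≢x (keep d) = keep (Del-∷ʳ⁻ xs (λ ()) d)
Del-∷ʳ⁻ (_ ∷ xs) {ys = _ ∷ _ ∷ _} last≢x (keep d) = keep (Del-∷ʳ⁻ xs last≢x d)
Del-∷ʳ⁻ {k = zero}  (_ ∷ xs) last≢x (skip d) = ⊥-elim (last≢x (trans (cong last (sym (Del-0⇒≡ d))) (last-∷ʳ xs)))
Del-∷ʳ⁻ {k = suc k} (_ ∷ xs) last≢x (skip d) = skip (Del-∷ʳ⁻ xs last≢x d)

Del-∷-∷ʳ⁻ : x ≢ y → x′ ≢ y′ → Del (2 + k) (x ∷ (xs ∷ʳ x′)) (y ∷ (ys ∷ʳ y′)) → Del k xs (y ∷ (ys ∷ʳ y′))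
Del-∷-∷ʳ⁻ x≢x x′≢y′ (keep d) = ⊥-elim (x≢x refl)
Del-∷-∷ʳ⁻ {y = y} {xs = xs} {ys = ys} x≢y x′≢y′ (skip d) =
  Del-∷ʳ⁻ xs (λ eq → x′≢y′ (just-injective (trans (sym eq) (last-∷ʳ (y ∷ ys))))) d

UniqueDel : ℕ → List A → Set
UniqueDel k xs = ∀ {ys ys′} → Del k xs ys → Del k xs ys′ → ys ≡ ys′

UniqueDel-∷ : UniqueDel k (x ∷ xs) → UniqueDel k xs
UniqueDel-∷ unique d d′ = ∷-injectiveʳ (unique (keep d) (keep d′))

-- Deleting {2,3} or {1,2} of a ∷ b ∷ c ∷ t leaves a ∷ t and c ∷ t; deleting {1,3} leaves b ∷ t.
UniqueDel₂-∷∷∷ : ∀ {a b c : A} t → UniqueDel 2 (a ∷ b ∷ c ∷ t) → a ≡ c × b ≡ c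
UniqueDel₂-∷∷∷ t unique =
    ∷-injectiveˡ (unique (keep (skip (skip (Del-refl t)))) (skip (skip (keep (Del-refl t)))))
  , ∷-injectiveˡ (unique (skip (keep (skip (Del-refl t)))) (skip (skip (keep (Del-refl t)))))

UniqueDel₂⇒replicate : ∀ {k} (xs : List A) → length xs ≡ 3 + k → UniqueDel 2 xs → ∃ λ c → xs ≡ replicate (3 + k) c
UniqueDel₂⇒replicate {k = zero} (a ∷ b ∷ c ∷ []) refl unique
  with refl , refl ← UniqueDel₂-∷∷∷ [] unique = c , refl
UniqueDel₂⇒replicate {k = suc k} (a ∷ b ∷ c ∷ x ∷ t) len unique
  with refl , refl ← UniqueDel₂-∷∷∷ (x ∷ t) unique
     | c′ , eq ← UniqueDel₂⇒replicate (b ∷ c ∷ x ∷ t) (suc-injective len) (UniqueDel-∷ unique)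
  = c′ , cong₂ _∷_ (∷-injectiveˡ eq) eq

Del₂-⊆⇒interior : x ≢ y → x′ ≢ y′
  → (∀ w → Del 2 (y ∷ (ys ∷ʳ y′)) w → Del 2 (x ∷ (xs ∷ʳ x′)) w)
  → Del 2 ys w → xs ≡ y ∷ (w ∷ʳ y′)
Del₂-⊆⇒interior {y′ = y′} x≢y x′≢y′ D₂⊆ d = Del-0⇒≡ (Del-∷-∷ʳ⁻ x≢y x′≢y′ (D₂⊆ _ (keep (Del-++ʳ [ y′ ] d))))

Del₂-⊆⇒UniqueDel : x ≢ y → x′ ≢ y′
  → (∀ w → Del 2 (y ∷ (ys ∷ʳ y′)) w → Del 2 (x ∷ (xs ∷ʳ x′)) w)
  → UniqueDel 2 ys
Del₂-⊆⇒UniqueDel x≢y x′≢y′ D₂⊆ d d′ =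
  ∷ʳ-injectiveˡ _ _ (∷-injectiveʳ (trans (sym (Del₂-⊆⇒interior x≢y x′≢y′ D₂⊆ d))
                                         (Del₂-⊆⇒interior x≢y x′≢y′ D₂⊆ d′)))

Del₂-⊆⇒replicate : ∀ {k} → x ≢ y → x′ ≢ y′
  → (∀ w → Del 2 (y ∷ (ys ∷ʳ y′)) w → Del 2 (x ∷ (xs ∷ʳ x′)) w)
  → length ys ≡ 3 + k → ∃ λ c → ys ≡ replicate (3 + k) c × xs ≡ y ∷ (replicate (1 + k) c ∷ʳ y′)
Del₂-⊆⇒replicate {ys = ys} x≢y x′≢y′ D₂⊆ |ys|
  with c , refl ← UniqueDel₂⇒replicate ys |ys| (Del₂-⊆⇒UniqueDel x≢y x′≢y′ D₂⊆)
  = c , refl , Del₂-⊆⇒interior x≢y x′≢y′ D₂⊆ (skip (skip (Del-refl (replicate (1 + _) c))))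

ExceptionalPair : ℕ → List Bool → List Bool → Set
ExceptionalPair n u v = Σ Transform λ T → Σ Bool λ p → Σ Bool λ q → q ≡ not p
  × ((apply T u ≡ q ∷ p ∷ (replicate (n ∸ 4) q ++ p ∷ q ∷ [])
      × apply T v ≡ p ∷ (replicate (n ∸ 2) q ++ p ∷ []))
    ⊎ (apply T u ≡ q ∷ (replicate (n ∸ 3) p ++ q ∷ p ∷ [])
      × apply T v ≡ replicate (n ∸ 1) p ++ q ∷ []))

exceptional₁ : ∀ k p q → q ≡ not p
  → ExceptionalPair (5 + k) (q ∷ ((p ∷ (replicate (1 + k) q ∷ʳ p)) ∷ʳ q)) (p ∷ (replicate (3 + k) q ∷ʳ p))
exceptional₁ k p q q≡¬p =
  identity , p , q , q≡¬p , inj₁ (cong (λ t → q ∷ p ∷ t) (++-assoc (replicate (1 + k) q) [ p ] [ q ]) , refl)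

exceptional₂ : ∀ k p q → q ≡ not p
  → ExceptionalPair (5 + k) (q ∷ ((p ∷ (replicate (1 + k) p ∷ʳ q)) ∷ʳ p)) (p ∷ (replicate (3 + k) p ∷ʳ q))
exceptional₂ k p q q≡¬p =
  identity , p , q , q≡¬p , inj₂ (cong (λ t → q ∷ p ∷ t) (++-assoc (replicate (1 + k) p) [ q ] [ p ]) , refl)

exceptional₂-reversed : ∀ k p q → p ≡ not q
  → ExceptionalPair (5 + k) (q ∷ ((p ∷ (replicate (1 + k) q ∷ʳ q)) ∷ʳ p)) (p ∷ (replicate (3 + k) q ∷ʳ q))
exceptional₂-reversed k p q p≡¬q = reversal , q , p , p≡¬q , inj₂ (reverse-u , reverse-v)
  where
  open ≡-Reasoning
  R = replicate (1 + k) q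
  reverse-u : reverse (q ∷ ((p ∷ (R ∷ʳ q)) ∷ʳ p)) ≡ p ∷ q ∷ (R ++ p ∷ q ∷ [])
  reverse-u = begin
    reverse (q ∷ ((p ∷ (R ∷ʳ q)) ∷ʳ p))  ≡⟨ reverse-∷-∷ʳ q (p ∷ (R ∷ʳ q)) p ⟩
    p ∷ (reverse (p ∷ (R ∷ʳ q)) ∷ʳ q)   ≡⟨ cong (λ t → p ∷ (t ∷ʳ q)) (reverse-∷-∷ʳ p R q) ⟩
    p ∷ q ∷ ((reverse R ∷ʳ p) ∷ʳ q)      ≡⟨ cong (λ t → p ∷ q ∷ ((t ∷ʳ p) ∷ʳ q)) (reverse-replicate (1 + k) q) ⟩
    p ∷ q ∷ ((R ∷ʳ p) ∷ʳ q)              ≡⟨ cong (λ t → p ∷ q ∷ t) (++-assoc R [ p ] [ q ]) ⟩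
    p ∷ q ∷ (R ++ p ∷ q ∷ [])            ∎
  reverse-v : reverse (p ∷ (replicate (3 + k) q ∷ʳ q)) ≡ q ∷ (replicate (3 + k) q ++ p ∷ [])
  reverse-v = begin
    reverse (p ∷ (replicate (3 + k) q ∷ʳ q))  ≡⟨ reverse-∷-∷ʳ p (replicate (3 + k) q) q ⟩
    q ∷ (reverse (replicate (3 + k) q) ∷ʳ p)  ≡⟨ cong (λ t → q ∷ (t ∷ʳ p)) (reverse-replicate (3 + k) q) ⟩
    q ∷ (replicate (3 + k) q ∷ʳ p)            ∎

exceptional : ∀ k p c r
  → p ∷ (replicate (3 + k) c ∷ʳ r) ≢ replicate (5 + k) false
  → p ∷ (replicate (3 + k) c ∷ʳ r) ≢ replicate (5 + k) true
  → ExceptionalPair (5 + k) (not p ∷ ((p ∷ (replicate (1 + k) c ∷ʳ r)) ∷ʳ not r)) (p ∷ (replicate (3 + k) c ∷ʳ r))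
exceptional k false false false v≢0ⁿ _ = ⊥-elim (v≢0ⁿ (cong (false ∷_) (replicate-∷ʳ (3 + k) false)))
exceptional k true  true  true  _ v≢1ⁿ = ⊥-elim (v≢1ⁿ (cong (true ∷_) (replicate-∷ʳ (3 + k) true)))
exceptional k false true  false _ _ = exceptional₁ k false true refl
exceptional k true  false true  _ _ = exceptional₁ k true false refl
exceptional k false false true  _ _ = exceptional₂ k false true refl
exceptional k true  true  false _ _ = exceptional₂ k true false refl
exceptional k false true  true  _ _ = exceptional₂-reversed k false true refl
exceptional k true  false false _ _ = exceptional₂-reversed k true false refl

proposition4 : (n : ℕ) → 5 ≤ n → (u v : List Bool) → length u ≡ n → length v ≡ n
    → v ≢ replicate n false → v ≢ replicate n true
    → u 2-dominant-over v → head u ≢ head v → last u ≢ last v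
    → Σ Transform λ T → Σ Bool λ p → Σ Bool λ q → q ≡ not p
      × ((apply T u ≡ q ∷ p ∷ (replicate (n ∸ 4) q ++ p ∷ q ∷ [])
          × apply T v ≡ p ∷ (replicate (n ∸ 2) q ++ p ∷ []))
        ⊎ (apply T u ≡ q ∷ (replicate (n ∸ 3) p ++ q ∷ p ∷ [])
          × apply T v ≡ replicate (n ∸ 1) p ++ q ∷ []))
proposition4 n 5≤n u v |u| |v| v≢0ⁿ v≢1ⁿ (_ , D₂v⊆D₂u) heads≢ lasts≢
  with k , refl ← m≤n⇒∃[o]m+o≡n 5≤n
  with q , mid , s , refl , _   ← ∷-∷ʳ-split u |u|
     | p , z   , r , refl , |z| ← ∷-∷ʳ-split v |v|
  with q≢p ← heads≢ ∘ cong just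
     | s≢r ← last-∷ʳ-≢ (q ∷ mid) (p ∷ z) lasts≢
  with c , refl , refl ← Del₂-⊆⇒replicate q≢p s≢r D₂v⊆D₂u |z|
     | refl ← ¬-not q≢p
     | refl ← ¬-not s≢r
  = exceptional k p c r v≢0ⁿ v≢1ⁿ
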